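{- Let $S$ be a stable cut in an unweighted graph $G=(V,E)$ with $m$ edges and maximum degree $\Delta$, such that $\varphi(S)<(m-\Delta)/2$. Then $S$ has a unique critical vertex $u$, and $u$ satisfies $$d_S(u)>\sum_{v\neq u}x_S(v)+\Delta-d(u)/2.$$ Moreover, $u$ has a neighbor $w$ on the opposite side of the cut (i.e., exactly one of $u,w$ lies in $S$) with $x_S(w)=0$.
   Context: For a cut $S\subseteq V$: $C_S$ is the number of edges with exactly one endpoint in $S$; $d(v)$ is the degree of $v$, $d_S(v)$ the number of edges at $v$ crossing $S$; the excess is $x_S(v)=d_S(v)-d(v)/2$. $S$ is stable if $d_S(v)>(d(v)-1)/2$ for every $v\in V$. $\varphi(S)=\min_{v\in V}C_{S-\{v\},G-\{v\}}$, where $G-\{v\}$ deletes $v$ and its incident edges. A vertex $v$ is critical for $S$ if $C_{S-\{v\},G-\{v\}}=\varphi(S)$. -}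

module Defs where

open import Data.Nat using (ℕ; zero; suc; _+_; _<_; _⊔_; _⊓_)
open import Data.Fin using (Fin; zero; suc; toℕ)
open import Data.Bool using (Bool; true; false; _∧_; _xor_; not)
open import Data.Integer using (ℤ; +_; _-_)
open import Relation.Binary.PropositionalEquality using (_≡_)
open import Relation.Nullary.Decidable using (⌊_⌋)
import Data.Nat as ℕ
import Data.Fin as F

record Graph (n : ℕ) : Set where
  field
    adj    : Fin n → Fin n → Bool
    sym    : ∀ i j → adj i j ≡ adj j i
    irrefl : ∀ i → adj i i ≡ false
open Graph public

Cut : ℕ → Set
Cut n = Fin n → Bool

ind : Bool → ℕ
ind true  = 1
ind false = 0

sumF : ∀ {n} → (Fin n → ℕ) → ℕ
sumF {zero}  f = 0
sumF {suc n} f = f zero + sumF (λ i → f (suc i))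

sumZ : ∀ {n} → (Fin n → ℤ) → ℤ
sumZ {zero}  f = + 0
sumZ {suc n} f = f zero Data.Integer.+ sumZ (λ i → f (suc i))

maxF : ∀ {n} → (Fin n → ℕ) → ℕ
maxF {zero}  f = 0
maxF {suc n} f = f zero ⊔ maxF (λ i → f (suc i))

minF : ∀ {n} → (Fin (suc n) → ℕ) → ℕ
minF {zero}  f = f zero
minF {suc n} f = f zero ⊓ minF (λ i → f (suc i))

crosses : ∀ {n} → Cut n → Fin n → Fin n → Bool
crosses S u v = S u xor S v

_<ᵇ_ : ∀ {n} → Fin n → Fin n → Bool
i <ᵇ j = ⌊ toℕ i ℕ.<? toℕ j ⌋

_≠ᵇ_ : ∀ {n} → Fin n → Fin n → Bool
i ≠ᵇ j = not ⌊ i F.≟ j ⌋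

module _ {n : ℕ} (G : Graph n) where

  numEdges : ℕ
  numEdges = sumF λ i → sumF λ j → ind ((i <ᵇ j) ∧ adj G i j)

  deg : Fin n → ℕ
  deg v = sumF λ j → ind (adj G v j)

  maxDeg : ℕ
  maxDeg = maxF deg

  degS : Cut n → Fin n → ℕ
  degS S v = sumF λ j → ind (adj G v j ∧ crosses S v j)

  cutSize : Cut n → ℕ
  cutSize S = sumF λ i → sumF λ j → ind ((i <ᵇ j) ∧ adj G i j ∧ crosses S i j)

  -- 2·x_S(v) = 2 d_S(v) - d(v)   (twice the excess, to stay integral)
  twiceExcess : Cut n → Fin n → ℤ
  twiceExcess S v = + (2 ℕ.* degS S v) - + deg v

  -- S stable : d_S(v) > (d(v) - 1)/2, i.e. 2 d_S(v) > d(v) - 1, i.e. d(v) < 2 d_S(v) + 1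
  Stable : Cut n → Set
  Stable S = ∀ v → deg v < 2 ℕ.* degS S v + 1

-- G - {v}: delete v and its incident edges (vertex set Fin n ∖ {v},
-- realised on Fin n with v isolated and excluded from the vertex set)
deleteVertex : ∀ {n} → Graph n → Fin n → Graph n
deleteVertex G v = record
  { adj    = λ i j → adj G i j ∧ (i ≠ᵇ v) ∧ (j ≠ᵇ v)
  ; sym    = λ i j → symProof i j
  ; irrefl = λ i → irr i }
  where
  open import Relation.Binary.PropositionalEquality using (cong₂; cong)
  open import Data.Bool.Properties using (∧-comm; ∧-zeroˡ)
  symProof : ∀ i j → (adj G i j ∧ (i ≠ᵇ v) ∧ (j ≠ᵇ v)) ≡ (adj G j i ∧ (j ≠ᵇ v) ∧ (i ≠ᵇ v))
  symProof i j = cong₂ _∧_ (sym G i j) (∧-comm (i ≠ᵇ v) (j ≠ᵇ v))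
  irr : ∀ i → (adj G i i ∧ (i ≠ᵇ v) ∧ (i ≠ᵇ v)) ≡ false
  irr i rewrite irrefl G i = Relation.Binary.PropositionalEquality.refl

cutMinus : ∀ {n} → Graph n → Cut n → Fin n → ℕ
cutMinus G S v = cutSize (deleteVertex G v) (λ i → S i ∧ (i ≠ᵇ v))

φ : ∀ {n} → Graph (suc n) → Cut (suc n) → ℕ
φ G S = minF (cutMinus G S)

Critical : ∀ {n} → Graph (suc n) → Cut (suc n) → Fin (suc n) → Set
Critical G S v = cutMinus G S v ≡ φ G S

sumExceptZ : ∀ {n} → Fin n → (Fin n → ℤ) → ℤ
sumExceptZ u f = sumZ (λ v → if v ≠ᵇ u then f v else + 0)
  where open import Data.Bool using (if_then_else_)

-- Deleting v removes exactly the d_S(v) crossing edges at v, so C_{S-v,G-v} = C_S - d_S(v) and the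
-- critical vertices are those of largest d_S. Writing e(v) = 2 x_S(v), which stability makes a natural
-- number, the handshake lemma gives Σ e = 4 C_S - 2 m; for a critical u the hypothesis
-- 2 φ(S) + Δ < m is then exactly the bound  Σ_{v≠u} e(v) + 2Δ < 2 d_S(u) + d(u).
-- A second critical vertex v has d_S(v) = d_S(u), hence 2 d_S(u) + d(u) = e(v) + d(v) + d(u)
-- ≤ Σ_{w≠u} e(w) + 2Δ, against the bound. Likewise, if every crossing neighbour w of u had e(w) ≥ 1,
-- then d_S(u) ≤ Σ_{w≠u} e(w), and 2 d_S(u) + d(u) ≤ d_S(u) + 2Δ ≤ Σ_{w≠u} e(w) + 2Δ again.
module Submission where

open import Defs renaming (sym to adj-sym)
open import Data.Bool using (Bool; true; false; _∧_; _xor_; not; if_then_else_)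
import Data.Bool as B
open import Data.Bool.Properties using (∧-identityʳ; ∧-zeroʳ; xor-comm)
open import Data.Fin as F using (Fin; zero; suc; toℕ)
import Data.Fin.Properties as FP
open import Data.Integer using (ℤ; +_; _-_; _⊖_) renaming (_+_ to _+ℤ_; _<_ to _<ℤ_)
import Data.Integer.Properties as ℤ
open import Data.List using (_∷_; [])
open import Data.Nat using (ℕ; zero; suc; _+_; _*_; _<_; _≤_; _∸_; _<?_; z≤n)
open import Data.Nat.Properties
open import Algebra.Properties.Semiring.Sum +-*-semiring
  using (sum; sum-cong-≗; ∑-distrib-+; ∑-comm; *-distribˡ-sum)
open import Data.Nat.Tactic.RingSolver using (solve-∀; solve)
open import Data.Product using (∃; _×_; _,_)
open import Data.Sum using (inj₁; inj₂)
open import Function using (_∘_)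
open import Relation.Binary.Definitions using (tri<; tri≈; tri>)
open import Relation.Binary.PropositionalEquality
  using (_≡_; _≢_; refl; sym; trans; cong; cong₂; subst; subst₂; module ≡-Reasoning)
open import Relation.Nullary using (¬_; Dec; yes; no; contradiction)
open import Relation.Nullary.Decidable using (⌊_⌋; isYes≗does; dec-true; dec-false; _×-dec_)

⌊⌋-true : ∀ {A : Set} (a? : Dec A) → A → ⌊ a? ⌋ ≡ true
⌊⌋-true a? a = trans (isYes≗does a?) (dec-true a? a)

⌊⌋-false : ∀ {A : Set} (a? : Dec A) → ¬ A → ⌊ a? ⌋ ≡ false
⌊⌋-false a? ¬a = trans (isYes≗does a?) (dec-false a? ¬a)

≠ᵇ-refl : ∀ {n} (v : Fin n) → (v ≠ᵇ v) ≡ false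
≠ᵇ-refl v = cong not (⌊⌋-true (v F.≟ v) refl)

≢⇒≠ᵇ : ∀ {n} {i v : Fin n} → i ≢ v → (i ≠ᵇ v) ≡ true
≢⇒≠ᵇ {i = i} {v} i≢v = cong not (⌊⌋-false (i F.≟ v) i≢v)

≠ᵇ≡false⇒≡ : ∀ {n} {i v : Fin n} → (i ≠ᵇ v) ≡ false → i ≡ v
≠ᵇ≡false⇒≡ {i = i} {v} i≠ᵇv with i F.≟ v
... | yes i≡v = i≡v

sumF≡sum : ∀ {n} (f : Fin n → ℕ) → sumF f ≡ sum f
sumF≡sum {zero}  f = refl
sumF≡sum {suc n} f = cong (_+_ (f zero)) (sumF≡sum (f ∘ suc))

sumF-cong : ∀ {n} {f g : Fin n → ℕ} → (∀ i → f i ≡ g i) → sumF f ≡ sumF g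
sumF-cong {f = f} {g} f≗g = trans (sumF≡sum f) (trans (sum-cong-≗ f≗g) (sym (sumF≡sum g)))

sumF-distrib-+ : ∀ {n} (f g : Fin n → ℕ) → sumF (λ i → f i + g i) ≡ sumF f + sumF g
sumF-distrib-+ f g = begin
  sumF (λ i → f i + g i) ≡⟨ sumF≡sum (λ i → f i + g i) ⟩
  sum (λ i → f i + g i)  ≡⟨ ∑-distrib-+ f g ⟩
  sum f + sum g          ≡⟨ cong₂ _+_ (sumF≡sum f) (sumF≡sum g) ⟨
  sumF f + sumF g        ∎
  where open ≡-Reasoning

sumF-distrib-+₃ : ∀ {n} (f g h : Fin n → ℕ) →
  sumF (λ i → f i + g i + h i) ≡ sumF f + sumF g + sumF h
sumF-distrib-+₃ f g h =
  trans (sumF-distrib-+ (λ i → f i + g i) h) (cong (_+ sumF h) (sumF-distrib-+ f g))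

*-distribˡ-sumF : ∀ {n} k (f : Fin n → ℕ) → sumF (λ i → k * f i) ≡ k * sumF f
*-distribˡ-sumF k f = begin
  sumF (λ i → k * f i) ≡⟨ sumF≡sum (λ i → k * f i) ⟩
  sum (λ i → k * f i)  ≡⟨ *-distribˡ-sum k f ⟨
  k * sum f            ≡⟨ cong (_*_ k) (sumF≡sum f) ⟨
  k * sumF f           ∎
  where open ≡-Reasoning

sumF-comm : ∀ {m n} (f : Fin m → Fin n → ℕ) →
  sumF (λ i → sumF (f i)) ≡ sumF (λ j → sumF (λ i → f i j))
sumF-comm f = begin
  sumF (λ i → sumF (f i))         ≡⟨ sumF-cong (λ i → sumF≡sum (f i)) ⟩
  sumF (λ i → sum (f i))          ≡⟨ sumF≡sum (λ i → sum (f i)) ⟩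
  sum (λ i → sum (f i))           ≡⟨ ∑-comm f ⟩
  sum (λ j → sum (λ i → f i j))   ≡⟨ sumF≡sum (λ j → sum (λ i → f i j)) ⟨
  sumF (λ j → sum (λ i → f i j))  ≡⟨ sumF-cong (λ j → sumF≡sum (λ i → f i j)) ⟨
  sumF (λ j → sumF (λ i → f i j)) ∎
  where open ≡-Reasoning

sumF-mono-≤ : ∀ {n} {f g : Fin n → ℕ} → (∀ i → f i ≤ g i) → sumF f ≤ sumF g
sumF-mono-≤ {zero}  f≤g = ≤-refl
sumF-mono-≤ {suc n} f≤g = +-mono-≤ (f≤g zero) (sumF-mono-≤ (f≤g ∘ suc))

sumF-zero : ∀ n → sumF {n} (λ _ → 0) ≡ 0
sumF-zero zero    = refl
sumF-zero (suc n) = sumF-zero n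

sumF-single : ∀ {n} (v : Fin n) (f : Fin n → ℕ) → (∀ i → i ≢ v → f i ≡ 0) → sumF f ≡ f v
sumF-single {suc n} zero f f≡0 = begin
  f zero + sumF (f ∘ suc)     ≡⟨ cong (_+_ (f zero)) (sumF-cong (λ i → f≡0 (suc i) λ ())) ⟩
  f zero + sumF {n} (λ _ → 0) ≡⟨ cong (_+_ (f zero)) (sumF-zero n) ⟩
  f zero + 0                  ≡⟨ +-identityʳ (f zero) ⟩
  f zero                      ∎
  where open ≡-Reasoning
sumF-single (suc v) f f≡0 =
  trans (cong (_+ sumF (f ∘ suc)) (f≡0 zero λ ()))
        (sumF-single v (f ∘ suc) (λ i i≢v → f≡0 (suc i) (i≢v ∘ FP.suc-injective)))

sumF-at : ∀ {n} (v : Fin n) (f : Fin n → ℕ) → sumF (λ i → if i ≠ᵇ v then 0 else f i) ≡ f v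
sumF-at v f =
  trans (sumF-single v _ (λ i i≢v → cong (if_then 0 else f i) (≢⇒≠ᵇ i≢v)))
        (cong (if_then 0 else f v) (≠ᵇ-refl v))

sumF-except : ∀ {n} (u : Fin n) (f : Fin n → ℕ) →
  sumF f ≡ f u + sumF (λ v → if v ≠ᵇ u then f v else 0)
sumF-except u f = begin
  sumF f                        ≡⟨ sumF-cong split ⟩
  sumF (λ v → at v + except v)  ≡⟨ sumF-distrib-+ at except ⟩
  sumF at + sumF except         ≡⟨ cong (_+ sumF except) (sumF-at u f) ⟩
  f u + sumF except             ∎
  where
  open ≡-Reasoning
  at except : _ → ℕ
  at v = if v ≠ᵇ u then 0 else f v
  except v = if v ≠ᵇ u then f v else 0
  split : ∀ v → f v ≡ at v + except v
  split v with v ≠ᵇ u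
  ... | true  = refl
  ... | false = sym (+-identityʳ (f v))

≤-sumF : ∀ {n} (f : Fin n → ℕ) v → f v ≤ sumF f
≤-sumF f v = subst (f v ≤_) (sym (sumF-except v f)) (m≤m+n (f v) _)

sumZ≡+sumF : ∀ {n} {g : Fin n → ℤ} (f : Fin n → ℕ) → (∀ i → g i ≡ + f i) → sumZ g ≡ + sumF f
sumZ≡+sumF {zero}  f g≗f = refl
sumZ≡+sumF {suc n} f g≗f = cong₂ _+ℤ_ (g≗f zero) (sumZ≡+sumF (f ∘ suc) (g≗f ∘ suc))

+[m+n]-+n≡+m : ∀ m n → + (m + n) - + n ≡ + m
+[m+n]-+n≡+m m n = begin
  + (m + n) - + n  ≡⟨ ℤ.[+m]-[+n]≡m⊖n (m + n) n ⟩
  (m + n) ⊖ n    ≡⟨ ℤ.⊖-≥ (m≤n+m n m) ⟩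
  + (m + n ∸ n)    ≡⟨ cong +_ (m+n∸n≡m m n) ⟩
  + m              ∎
  where open ≡-Reasoning

minF-attained : ∀ {n} (f : Fin (suc n) → ℕ) → ∃ λ u → minF f ≡ f u
minF-attained {zero}  f = zero , refl
minF-attained {suc n} f with ⊓-sel (f zero) (minF (f ∘ suc))
... | inj₁ min≡f0 = zero , min≡f0
... | inj₂ min≡rest with minF-attained (f ∘ suc)
...   | u , rest≡fu = suc u , trans min≡rest rest≡fu

≤-maxF : ∀ {n} (f : Fin n → ℕ) v → f v ≤ maxF f
≤-maxF f zero    = m≤m⊔n (f zero) _
≤-maxF f (suc v) = m≤n⇒m≤o⊔n (f zero) (≤-maxF (f ∘ suc) v)

ind-split-< : ∀ {n} (h : Fin n → Fin n → Bool) → (∀ i j → h i j ≡ h j i) → (∀ i → h i i ≡ false) →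
  ∀ i j → ind (h i j) ≡ ind ((i <ᵇ j) ∧ h i j) + ind ((j <ᵇ i) ∧ h j i)
ind-split-< h h-sym h-irr i j with FP.<-cmp i j
... | tri< i<j _ j≮i
  rewrite ⌊⌋-true (toℕ i <? toℕ j) i<j | ⌊⌋-false (toℕ j <? toℕ i) j≮i = sym (+-identityʳ _)
... | tri> i≮j _ j<i
  rewrite ⌊⌋-false (toℕ i <? toℕ j) i≮j | ⌊⌋-true (toℕ j <? toℕ i) j<i = cong ind (h-sym i j)
... | tri≈ _ refl _ rewrite h-irr i | ∧-zeroʳ (i <ᵇ i) = refl

handshake : ∀ {n} (h : Fin n → Fin n → Bool) → (∀ i j → h i j ≡ h j i) → (∀ i → h i i ≡ false) →
  sumF (λ i → sumF (λ j → ind (h i j))) ≡ 2 * sumF (λ i → sumF (λ j → ind ((i <ᵇ j) ∧ h i j)))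
handshake h h-sym h-irr = begin
  sumF (λ i → sumF (λ j → ind (h i j)))
    ≡⟨ sumF-cong (λ i → trans (sumF-cong (ind-split-< h h-sym h-irr i)) (sumF-distrib-+ (up i) (down i))) ⟩
  sumF (λ i → sumF (up i) + sumF (down i))
    ≡⟨ sumF-distrib-+ (λ i → sumF (up i)) (λ i → sumF (down i)) ⟩
  E + sumF (λ i → sumF (down i))
    ≡⟨ cong (_+_ E) (sumF-comm down) ⟩
  E + E
    ≡⟨ cong (_+_ E) (+-identityʳ E) ⟨
  2 * E ∎
  where
  open ≡-Reasoning
  up down : Fin _ → Fin _ → ℕ
  up i j = ind ((i <ᵇ j) ∧ h i j)
  down i j = ind ((j <ᵇ i) ∧ h j i)
  E : ℕ
  E = sumF (λ i → sumF (up i))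

module _ {n} (G : Graph n) where

  handshake-deg : sumF (deg G) ≡ 2 * numEdges G
  handshake-deg = handshake (adj G) (adj-sym G) (irrefl G)

  handshake-degS : ∀ S → sumF (degS G S) ≡ 2 * cutSize G S
  handshake-degS S = handshake (λ i j → adj G i j ∧ crosses S i j)
    (λ i j → cong₂ _∧_ (adj-sym G i j) (xor-comm (S i) (S j)))
    (λ i → cong (_∧ crosses S i i) (irrefl G i))

  degS≤deg : ∀ S v → degS G S v ≤ deg G v
  degS≤deg S v = sumF-mono-≤ (λ j → ind-∧≤ (adj G v j) (crosses S v j))
    where
    ind-∧≤ : ∀ a b → ind (a ∧ b) ≤ ind a
    ind-∧≤ false b     = z≤n
    ind-∧≤ true  false = z≤n
    ind-∧≤ true  true  = ≤-refl

ind-crossing-split : ∀ a si sj ni nj → (ni ≡ false → nj ≡ false → a ≡ false) →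
  ind (a ∧ (si xor sj))
    ≡ ind ((a ∧ ni ∧ nj) ∧ ((si ∧ ni) xor (sj ∧ nj)))
      + (if ni then 0 else ind (a ∧ (si xor sj)))
      + (if nj then 0 else ind (a ∧ (si xor sj)))
ind-crossing-split a si sj true true _
  rewrite ∧-identityʳ a | ∧-identityʳ si | ∧-identityʳ sj =
  sym (trans (+-identityʳ _) (+-identityʳ _))
ind-crossing-split a si sj true  false _ rewrite ∧-zeroʳ a = refl
ind-crossing-split a si sj false true  _ rewrite ∧-zeroʳ a = sym (+-identityʳ _)
ind-crossing-split a si sj false false a≡false rewrite a≡false refl refl = refl

-- Each crossing edge of G either crosses S - v in G - v or has v as an endpoint; counting ordered pairs,
-- the pairs (v, j) and (i, v) each contribute d_S(v).
cutMinus+degS≡cutSize : ∀ {n} (G : Graph n) (S : Cut n) v →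
  cutMinus G S v + degS G S v ≡ cutSize G S
cutMinus+degS≡cutSize {n} G S v = *-cancelˡ-≡ _ _ 2 (begin
  2 * (c + d)
    ≡⟨ twice-+ c d ⟩
  2 * c + d + d
    ≡⟨ cong₂ _+_ (cong₂ _+_ (handshake-degS G′ S′) (sumF-at v row)) sum-columnᵥ ⟨
  sumF (degS G′ S′) + sumF rowᵥ + sumF columnᵥ
    ≡⟨ sumF-distrib-+₃ (degS G′ S′) rowᵥ columnᵥ ⟨
  sumF (λ i → degS G′ S′ i + rowᵥ i + columnᵥ i)
    ≡⟨ sumF-cong row-split ⟨
  sumF row
    ≡⟨ handshake-degS G S ⟩
  2 * cutSize G S ∎)
  where
  open ≡-Reasoning
  twice-+ : ∀ c d → 2 * (c + d) ≡ 2 * c + d + d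
  twice-+ = solve-∀
  G′ : Graph n
  G′ = deleteVertex G v
  S′ : Cut n
  S′ i = S i ∧ (i ≠ᵇ v)
  c d : ℕ
  c = cutMinus G S v
  d = degS G S v
  crossing : Fin n → Fin n → ℕ
  crossing i j = ind (adj G i j ∧ crosses S i j)
  row rowᵥ columnᵥ : Fin n → ℕ
  row i = sumF (crossing i)
  rowᵥ i = if i ≠ᵇ v then 0 else row i
  columnᵥ i = crossing i v
  row-split : ∀ i → row i ≡ degS G′ S′ i + rowᵥ i + columnᵥ i
  row-split i = trans
    (sumF-cong λ j → ind-crossing-split (adj G i j) (S i) (S j) (i ≠ᵇ v) (j ≠ᵇ v) (no-loop j))
    (trans (sumF-distrib-+₃ {n} _ _ _) (cong₂ _+_ (cong₂ _+_ refl sum-rowᵥ) (sumF-at v (crossing i))))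
    where
    sum-rowᵥ : sumF (λ j → if i ≠ᵇ v then 0 else crossing i j) ≡ rowᵥ i
    sum-rowᵥ with i ≠ᵇ v
    ... | true  = sumF-zero n
    ... | false = refl
    no-loop : ∀ j → (i ≠ᵇ v) ≡ false → (j ≠ᵇ v) ≡ false → adj G i j ≡ false
    no-loop j i≡v j≡v rewrite ≠ᵇ≡false⇒≡ i≡v | ≠ᵇ≡false⇒≡ j≡v = irrefl G v
  sum-columnᵥ : sumF columnᵥ ≡ d
  sum-columnᵥ = sumF-cong λ i → cong₂ (λ a b → ind (a ∧ b)) (adj-sym G i v) (xor-comm (S i) (S v))

module _ {n} (G : Graph n) (S : Cut n) where

  -- e(v) = 2 x_S(v); the truncated subtraction loses nothing once S is stable (see excess+deg).
  excess : Fin n → ℕ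
  excess v = 2 * degS G S v ∸ deg G v

  excessExcept : Fin n → ℕ
  excessExcept u = sumF (λ v → if v ≠ᵇ u then excess v else 0)

  -- The paper's d_S(u) > Σ_{v≠u} x_S(v) + Δ - d(u)/2, doubled and with d(u) moved across.
  ExcessBound : Fin n → Set
  ExcessBound u = excessExcept u + 2 * maxDeg G < 2 * degS G S u + deg G u

  module _ (stable : Stable G S) where

    excess+deg : ∀ v → excess v + deg G v ≡ 2 * degS G S v
    excess+deg v = m∸n+n≡m (m<1+n⇒m≤n (subst (deg G v <_) (+-comm (2 * degS G S v) 1) (stable v)))

    twiceExcess≡excess : ∀ v → twiceExcess G S v ≡ + excess v
    twiceExcess≡excess v = trans (cong (λ x → + x - + deg G v) (sym (excess+deg v)))
                                 (+[m+n]-+n≡+m (excess v) (deg G v))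

    sumExceptZ-twiceExcess : ∀ u → sumExceptZ u (twiceExcess G S) ≡ + excessExcept u
    sumExceptZ-twiceExcess u = sumZ≡+sumF (λ v → if v ≠ᵇ u then excess v else 0) except
      where
      except : ∀ v → (if v ≠ᵇ u then twiceExcess G S v else + 0) ≡ + (if v ≠ᵇ u then excess v else 0)
      except v with v ≠ᵇ u
      ... | true  = twiceExcess≡excess v
      ... | false = refl

    sumF-excess : sumF excess + 2 * numEdges G ≡ 2 * (2 * cutSize G S)
    sumF-excess = begin
      sumF excess + 2 * numEdges G      ≡⟨ cong (_+_ (sumF excess)) (handshake-deg G) ⟨
      sumF excess + sumF (deg G)        ≡⟨ sumF-distrib-+ excess (deg G) ⟨
      sumF (λ v → excess v + deg G v)   ≡⟨ sumF-cong excess+deg ⟩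
      sumF (λ v → 2 * degS G S v)       ≡⟨ *-distribˡ-sumF 2 (degS G S) ⟩
      2 * sumF (degS G S)               ≡⟨ cong (_*_ 2) (handshake-degS G S) ⟩
      2 * (2 * cutSize G S)             ∎
      where open ≡-Reasoning

    ExcessBound⇒ℤ : ∀ {u} → ExcessBound u →
      sumExceptZ u (twiceExcess G S) +ℤ + (2 * maxDeg G) - + deg G u <ℤ + (2 * degS G S u)
    ExcessBound⇒ℤ {u} bound = subst₂ _<ℤ_ lhs rhs (ℤ.⊖-monoˡ-< (deg G u) bound)
      where
      lhs : (excessExcept u + 2 * maxDeg G) ⊖ deg G u
              ≡ sumExceptZ u (twiceExcess G S) +ℤ + (2 * maxDeg G) - + deg G u
      lhs = trans (sym (ℤ.[+m]-[+n]≡m⊖n (excessExcept u + 2 * maxDeg G) (deg G u)))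
                  (cong (λ x → x +ℤ + (2 * maxDeg G) - + deg G u) (sym (sumExceptZ-twiceExcess u)))
      rhs : (2 * degS G S u + deg G u) ⊖ deg G u ≡ + (2 * degS G S u)
      rhs = trans (sym (ℤ.[+m]-[+n]≡m⊖n (2 * degS G S u + deg G u) (deg G u)))
                  (+[m+n]-+n≡+m (2 * degS G S u) (deg G u))

excessBound-arith : ∀ eu E m Δ c D du →
  eu + E + 2 * m ≡ 2 * (2 * (c + D)) → eu + du ≡ 2 * D → 2 * c + Δ < m → E + 2 * Δ < 2 * D + du
excessBound-arith eu E m Δ c D du total eu+du small = +-cancelˡ-< (eu + 2 * m) _ _ (begin-strict
  eu + 2 * m + (E + 2 * Δ)        ≡⟨ solve (eu ∷ E ∷ m ∷ Δ ∷ []) ⟩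
  eu + E + 2 * m + 2 * Δ          ≡⟨ cong (_+ 2 * Δ) total ⟩
  2 * (2 * (c + D)) + 2 * Δ       ≡⟨ solve (c ∷ D ∷ Δ ∷ []) ⟩
  2 * (2 * c + Δ) + 2 * (2 * D)   <⟨ +-monoˡ-< (2 * (2 * D)) (*-monoʳ-< 2 small) ⟩
  2 * m + 2 * (2 * D)             ≡⟨ solve (m ∷ D ∷ []) ⟩
  2 * m + (2 * D + 2 * D)         ≡⟨ cong (λ x → 2 * m + (2 * D + x)) eu+du ⟨
  2 * m + (2 * D + (eu + du))     ≡⟨ solve (m ∷ D ∷ eu ∷ du ∷ []) ⟩
  eu + 2 * m + (2 * D + du)       ∎)
  where open ≤-Reasoning

module _ {n} (G : Graph (suc n)) (S : Cut (suc n)) (stable : Stable G S) where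

  critical⇒ExcessBound : 2 * φ G S + maxDeg G < numEdges G →
    ∀ {u} → Critical G S u → ExcessBound G S u
  critical⇒ExcessBound small {u} critical =
    excessBound-arith (excess G S u) (excessExcept G S u) (numEdges G) (maxDeg G)
                      (cutMinus G S u) (degS G S u) (deg G u)
                      total (excess+deg G S stable u) small-at-u
    where
    open ≡-Reasoning
    small-at-u : 2 * cutMinus G S u + maxDeg G < numEdges G
    small-at-u = subst (λ x → 2 * x + maxDeg G < numEdges G) (sym critical) small
    total : excess G S u + excessExcept G S u + 2 * numEdges G ≡ 2 * (2 * (cutMinus G S u + degS G S u))
    total = begin
      excess G S u + excessExcept G S u + 2 * numEdges G ≡⟨ cong (_+ 2 * numEdges G) (sumF-except u (excess G S)) ⟨
      sumF (excess G S) + 2 * numEdges G                 ≡⟨ sumF-excess G S stable ⟩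
      2 * (2 * cutSize G S)                              ≡⟨ cong (λ x → 2 * (2 * x)) (cutMinus+degS≡cutSize G S u) ⟨
      2 * (2 * (cutMinus G S u + degS G S u))            ∎

  critical-unique : ∀ {u} → Critical G S u → ExcessBound G S u → ∀ v → Critical G S v → v ≡ u
  critical-unique {u} critical-u bound v critical-v with v F.≟ u
  ... | yes v≡u = v≡u
  ... | no  v≢u = contradiction (begin
      2 * degS G S u + deg G u          ≡⟨ cong (λ x → 2 * x + deg G u) same-degS ⟨
      2 * degS G S v + deg G u          ≡⟨ cong (_+ deg G u) (excess+deg G S stable v) ⟨
      excess G S v + deg G v + deg G u  ≤⟨ +-mono-≤ (+-mono-≤ excess-v≤ (≤-maxF (deg G) v)) (≤-maxF (deg G) u) ⟩
      excessExcept G S u + Δ + Δ        ≡⟨ +-assoc (excessExcept G S u) Δ Δ ⟩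
      excessExcept G S u + (Δ + Δ)      ≡⟨ cong (λ x → excessExcept G S u + (Δ + x)) (+-identityʳ Δ) ⟨
      excessExcept G S u + 2 * Δ        ∎) (<⇒≱ bound)
    where
    open ≤-Reasoning
    Δ = maxDeg G
    same-degS : degS G S v ≡ degS G S u
    same-degS = +-cancelˡ-≡ (cutMinus G S u) _ _ (begin-equality
      cutMinus G S u + degS G S v ≡⟨ cong (_+ degS G S v) (trans critical-v (sym critical-u)) ⟨
      cutMinus G S v + degS G S v ≡⟨ cutMinus+degS≡cutSize G S v ⟩
      cutSize G S                 ≡⟨ cutMinus+degS≡cutSize G S u ⟨
      cutMinus G S u + degS G S u ∎)
    excess-v≤ : excess G S v ≤ excessExcept G S u
    excess-v≤ = subst (_≤ excessExcept G S u) (cong (if_then excess G S v else 0) (≢⇒≠ᵇ v≢u))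
                      (≤-sumF (λ w → if w ≠ᵇ u then excess G S w else 0) v)

  balanced-crossing-neighbour : ∀ {u} → ExcessBound G S u →
    ∃ λ w → adj G u w ≡ true × crosses S u w ≡ true × twiceExcess G S w ≡ + 0
  balanced-crossing-neighbour {u} bound 
    with FP.any? (λ w → (adj G u w B.≟ true) ×-dec (crosses S u w B.≟ true) ×-dec (excess G S w ≟ 0))
  ... | yes (w , u~w , crossing , excess≡0) =
    w , u~w , crossing , trans (twiceExcess≡excess G S stable w) (cong +_ excess≡0)
  ... | no ¬balanced = contradiction (begin
      2 * D + deg G u              ≡⟨ cong (λ x → D + x + deg G u) (+-identityʳ D) ⟩
      D + D + deg G u              ≡⟨ +-assoc D D (deg G u) ⟩
      D + (D + deg G u)            ≤⟨ +-mono-≤ D≤excessExcept (+-mono-≤ (≤-trans (degS≤deg G S u) du≤Δ) du≤Δ) ⟩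
      excessExcept G S u + (Δ + Δ) ≡⟨ cong (λ x → excessExcept G S u + (Δ + x)) (+-identityʳ Δ) ⟨
      excessExcept G S u + 2 * Δ   ∎) (<⇒≱ bound)
    where
    open ≤-Reasoning
    D = degS G S u
    Δ = maxDeg G
    du≤Δ : deg G u ≤ Δ
    du≤Δ = ≤-maxF (deg G) u
    D≤excessExcept : D ≤ excessExcept G S u
    D≤excessExcept = sumF-mono-≤ crossing≤excess
      where
      crossing≤excess : ∀ w → ind (adj G u w ∧ crosses S u w) ≤ (if w ≠ᵇ u then excess G S w else 0)
      crossing≤excess w with adj G u w in u~w | crosses S u w in crossing
      ... | false | _     = z≤n
      ... | true  | false = z≤n
      ... | true  | true  = subst (1 ≤_) (sym (cong (if_then excess G S w else 0) (≢⇒≠ᵇ w≢u)))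
                                  (n≢0⇒n>0 (λ excess≡0 → ¬balanced (w , u~w , crossing , excess≡0)))
        where
        w≢u : w ≢ u
        w≢u refl = contradiction (trans (sym u~w) (irrefl G u)) λ ()

lemma24 : ∀ {n} (G : Graph (suc n)) (S : Cut (suc n))
    → Stable G S
    → 2 * φ G S + maxDeg G < numEdges G
    → ∃ λ (u : Fin (suc n))
        → Critical G S u
        × (∀ v → Critical G S v → v ≡ u)
        × (sumExceptZ u (twiceExcess G S) +ℤ + (2 * maxDeg G) - + deg G u
             <ℤ + (2 * degS G S u))
        × (∃ λ (w : Fin (suc n))
             → adj G u w ≡ true
             × crosses S u w ≡ true
             × twiceExcess G S w ≡ + 0)
lemma24 G S stable small with minF-attained (cutMinus G S)
... | u , φ≡cutMinus =
  u , critical , critical-unique G S stable critical bound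
    , ExcessBound⇒ℤ G S stable bound , balanced-crossing-neighbour G S stable bound
  where
  critical : Critical G S u
  critical = sym φ≡cutMinus
  bound : ExcessBound G S u
  bound = critical⇒ExcessBound G S stable small critical
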